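{- Let $t\ge 2$, $n\ge 18t$, and let $\pi=(d_1,\ldots,d_n)$ be a graphic sequence satisfying (i) $d_i\ge 3t-\lceil i/2\rceil$ for $i=1,\ldots,2t$; (ii) $d_{2t+1}\ge 2t$; (iii) $d_n\ge 2t-1$. If the sequence $\pi_{3t}$ (defined below) is graphic, then $\pi$ has a realization containing $G(3t)$.
   Context: A non-increasing sequence of nonnegative integers is graphic if it is the degree sequence of a simple graph (a realization). $G(3t)$ is the graph obtained from $K_{2t}$ on vertices $v_1,\ldots,v_{2t}$ by adding new vertices $x_1,\ldots,x_t$ and joining $x_i$ to $v_1,\ldots,v_{2i}$ for $1\le i\le t$. Let $\pi_0=\pi$. The sequence $\pi_1=(d_2^{(1)},\ldots,d_n^{(1)})$ is obtained from $\pi_0$ by deleting $d_1$, decreasing the first $d_1$ remaining nonzero terms each by one, and reordering the last $n-3t$ terms (positions $3t+1,\ldots,n$) to be non-increasing. For $2\le i\le 3t$, $\pi_i=(d_{i+1}^{(i)},\ldots,d_n^{(i)})$ is obtained from $\pi_{i-1}=(d_i^{(i-1)},\ldots,d_n^{(i-1)})$ by deleting $d_i^{(i-1)}$, decreasing the first $d_i^{(i-1)}$ remaining nonzero terms each by one, and reordering the last $n-3t$ terms to be non-increasing. -}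

module Defs where

open import Data.Nat using (ℕ; zero; suc; _+_; _*_; _∸_; _≤_; _<_; _≥_; ⌈_/2⌉)
open import Data.Nat.Properties using (≤-decTotalOrder)
open import Data.Bool using (Bool; true; false; if_then_else_)
open import Data.Fin using (Fin; toℕ)
open import Data.List using (List; []; _∷_; length; take; drop; _++_; reverse; map; lookup)
open import Data.Nat.ListAction using (sum)
open import Data.List.Relation.Unary.Linked using (Linked)
open import Data.List.Sort ≤-decTotalOrder using (sort)
open import Data.Maybe using (Maybe; just; nothing; _>>=_)
import Data.Maybe as Maybe
open import Data.Vec.Functional using () renaming (Vector to Vect)
open import Data.List using (allFin)
open import Data.Product using (Σ; _×_; _,_)
open import Data.Sum using (_⊎_)
open import Relation.Binary.PropositionalEquality using (_≡_)
open import Function.Definitions using (Injective)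

-- 1-indexed access d_i (value 0 outside 1..length)
nth : List ℕ → ℕ → ℕ
nth []       _             = 0
nth (x ∷ xs) zero          = 0
nth (x ∷ xs) (suc zero)    = x
nth (x ∷ xs) (suc (suc i)) = nth xs (suc i)

NonIncreasing : List ℕ → Set
NonIncreasing = Linked _≥_

record SimpleGraph (n : ℕ) : Set where
  field
    adj   : Fin n → Fin n → Bool
    sym   : ∀ i j → adj i j ≡ adj j i
    irrefl : ∀ i → adj i i ≡ false
open SimpleGraph public

degree : ∀ {n} → SimpleGraph n → Fin n → ℕ
degree {n} G i = sum (map (λ j → if adj G i j then 1 else 0) (allFin n))

-- G realizes the sequence ds (vertex i has degree d_{i+1})
Realizes : (ds : List ℕ) → SimpleGraph (length ds) → Set
Realizes ds G = ∀ i → degree G i ≡ lookup ds i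

Graphic : List ℕ → Set
Graphic ds = NonIncreasing ds × Σ (SimpleGraph (length ds)) (Realizes ds)

-- The graph G(3t) on vertex set Fin (3t):
-- index a < 2t is v_{a+1};  index 2t + (i-1) is x_i  (1 ≤ i ≤ t).

-- edges v_a v_b (a ≠ b) and x_i v_j for j ≤ 2i, in oriented form
GEdge′ : (t a b : ℕ) → Set
GEdge′ t a b =
    (a < 2 * t × b < 2 * t × (a ≡ b → Data.Empty.⊥))
  ⊎ (2 * t ≤ a × a < 3 * t × b < 2 * suc (a ∸ 2 * t))
  where import Data.Empty

GEdge : (t : ℕ) → Fin (3 * t) → Fin (3 * t) → Set
GEdge t a b = GEdge′ t (toℕ a) (toℕ b) ⊎ GEdge′ t (toℕ b) (toℕ a)

ContainsG3t : (t : ℕ) → ∀ {n} → SimpleGraph n → Set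
ContainsG3t t {n} H =
  Σ (Fin (3 * t) → Fin n) λ f →
    Injective _≡_ _≡_ f × (∀ a b → GEdge t a b → adj H (f a) (f b) ≡ true)

decFirstNonzero : ℕ → List ℕ → Maybe (List ℕ)
decFirstNonzero zero    xs             = just xs
decFirstNonzero (suc k) []             = nothing
decFirstNonzero (suc k) (zero ∷ xs)    = Maybe.map (zero ∷_) (decFirstNonzero (suc k) xs)
decFirstNonzero (suc k) (suc x ∷ xs)   = Maybe.map (x ∷_) (decFirstNonzero k xs)

sortDesc : List ℕ → List ℕ
sortDesc xs = reverse (sort xs)

reorderLast : ℕ → List ℕ → List ℕ
reorderLast m xs = take (length xs ∸ m) xs ++ sortDesc (drop (length xs ∸ m) xs)

layStep : ℕ → List ℕ → Maybe (List ℕ)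
layStep m []       = nothing
layStep m (d ∷ xs) = Maybe.map (reorderLast m) (decFirstNonzero d xs)

laying : (n t : ℕ) → ℕ → List ℕ → Maybe (List ℕ)
laying n t zero    π = just π
laying n t (suc k) π = laying n t k π >>= layStep (n ∸ 3 * t)

module Submission where

-- Place the vertices of G(3t) at positions 0,…,3t-1 in the order
-- v_1,…,v_{2t},x_t,…,x_1.  Then two positions a < b are adjacent in G(3t)
-- exactly when a + 1 + 2b ≤ 6t; this relation is called `Pattern` below.
--
-- The proof runs the laying-off backwards.  Starting from a realization of
-- π_{3t}, a realization of π_k is rebuilt from one of π_{k+1}: first it is
-- relabelled along the reordering of the tail (which never moves the first
-- 3t-k-1 positions), then a new vertex of degree d^{(k)}_k is joined to the
-- vertices whose terms were decreased.  The invariant is that positions p < q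
-- of π_k are adjacent whenever Pattern (k+p) (k+q).  The new vertex k reaches
-- every q with Pattern k (k+q): by the bound d^{(k)}_{k+p} ≥ d_{k+p} - k along
-- the laying-off and conditions (i)–(iii), such a q lies among the first
-- d^{(k)}_k positions and its term is still positive.

open import Defs hiding (sym)
open import Data.Nat
open import Data.Nat.Properties
open import Data.Nat.Tactic.RingSolver using (solve-∀)
open import Data.Nat.ListAction using (sum)
open import Data.Bool using (Bool; true; false; if_then_else_)
open import Data.Empty using (⊥-elim)
open import Data.Fin using (Fin; zero; suc; toℕ; fromℕ<)
open import Data.Fin.Properties using (toℕ<n; toℕ-fromℕ<; toℕ-injective)
open import Data.List using (List; []; _∷_; length; take; drop; _++_; lookup; tabulate)
open import Data.List.Properties using (map-tabulate; take++drop≡id)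
open import Data.List.Relation.Binary.Permutation.Propositional using (_↭_; prep; swap; ↭-sym) renaming (refl to ↭-refl; trans to ↭-trans)
open import Data.List.Relation.Binary.Permutation.Propositional.Properties using (↭-reverse; ↭-length; ++⁺ˡ)
open import Data.List.Sort ≤-decTotalOrder using (sort; sort-↭)
open import Data.List.Relation.Unary.Linked using (_∷_)
open import Data.Maybe using (just; _>>=_)
open import Data.Product using (Σ; _×_; _,_; proj₁; proj₂)
open import Data.Sum using (_⊎_; inj₁; inj₂) renaming (swap to ⊎-swap)
open import Relation.Nullary using (yes; no)
open import Relation.Binary.Definitions using (tri<; tri≈; tri>)
open import Relation.Binary.PropositionalEquality
open import Function using (_∘_; id)

finSum : ∀ {n} → (Fin n → ℕ) → ℕ
finSum {zero}  f = 0
finSum {suc n} f = f zero + finSum (f ∘ suc)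

finSum-zero : ∀ n → finSum {n} (λ _ → 0) ≡ 0
finSum-zero zero    = refl
finSum-zero (suc n) = finSum-zero n

sum-tabulate : ∀ {n} (f : Fin n → ℕ) → sum (tabulate f) ≡ finSum f
sum-tabulate {zero}  f = refl
sum-tabulate {suc n} f = cong (f zero +_) (sum-tabulate (f ∘ suc))

indicator : Bool → ℕ
indicator b = if b then 1 else 0

degree-finSum : ∀ {n} (G : SimpleGraph n) i →
                degree G i ≡ finSum (λ j → indicator (adj G i j))
degree-finSum G i = trans (cong sum (map-tabulate id row)) (sum-tabulate row)
  where row = λ j → indicator (adj G i j)

-- An index map from xs to ys that preserves entries and leaves every sum over
-- the indices of ys unchanged (in effect a bijection).
record Reindexing (xs ys : List ℕ) : Set where
  field
    index        : Fin (length xs) → Fin (length ys)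
    lookup-index : ∀ i → lookup ys (index i) ≡ lookup xs i
    finSum-index : ∀ (g : Fin (length ys) → ℕ) → finSum (g ∘ index) ≡ finSum g
open Reindexing

reindex-id : ∀ xs → Reindexing xs xs
reindex-id xs = record { index = id ; lookup-index = λ _ → refl ; finSum-index = λ _ → refl }

reindex-cons : ∀ {xs ys} x → Reindexing xs ys → Reindexing (x ∷ xs) (x ∷ ys)
reindex-cons {xs} {ys} x M = record { index = ix ; lookup-index = lk ; finSum-index = sm }
  where
  ix : Fin (suc (length xs)) → Fin (suc (length ys))
  ix zero    = zero
  ix (suc i) = suc (index M i)
  lk : ∀ i → lookup (x ∷ ys) (ix i) ≡ lookup (x ∷ xs) i
  lk zero    = refl
  lk (suc i) = lookup-index M i
  sm : ∀ g → finSum (g ∘ ix) ≡ finSum g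
  sm g = cong (g zero +_) (finSum-index M (g ∘ suc))

reindex-swap : ∀ {xs ys} x y → Reindexing xs ys → Reindexing (x ∷ y ∷ xs) (y ∷ x ∷ ys)
reindex-swap {xs} {ys} x y M = record { index = ix ; lookup-index = lk ; finSum-index = sm }
  where
  ix : Fin (suc (suc (length xs))) → Fin (suc (suc (length ys)))
  ix zero          = suc zero
  ix (suc zero)    = zero
  ix (suc (suc i)) = suc (suc (index M i))
  lk : ∀ i → lookup (y ∷ x ∷ ys) (ix i) ≡ lookup (x ∷ y ∷ xs) i
  lk zero          = refl
  lk (suc zero)    = refl
  lk (suc (suc i)) = lookup-index M i
  exchange : ∀ a b c → b + (a + c) ≡ a + (b + c)
  exchange = solve-∀
  sm : ∀ g → finSum (g ∘ ix) ≡ finSum g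
  sm g = trans (cong (λ s → g (suc zero) + (g zero + s)) (finSum-index M (λ i → g (suc (suc i)))))
               (exchange (g zero) (g (suc zero)) _)

reindex-∘ : ∀ {xs ys zs} → Reindexing xs ys → Reindexing ys zs → Reindexing xs zs
reindex-∘ M N = record
  { index        = index N ∘ index M
  ; lookup-index = λ i → trans (lookup-index N (index M i)) (lookup-index M i)
  ; finSum-index = λ g → trans (finSum-index M (g ∘ index N)) (finSum-index N g) }

reindex-↭ : ∀ {xs ys} → xs ↭ ys → Reindexing xs ys
reindex-↭ {xs} ↭-refl  = reindex-id xs
reindex-↭ (prep x p)   = reindex-cons x (reindex-↭ p)
reindex-↭ (swap x y p) = reindex-swap x y (reindex-↭ p)
reindex-↭ (↭-trans p q) = reindex-∘ (reindex-↭ p) (reindex-↭ q)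

reindex-after : ∀ K ys zs → drop K ys ↭ zs →
  Σ (Reindexing ys (take K ys ++ zs)) λ M → ∀ i → toℕ i < K → toℕ (index M i) ≡ toℕ i
reindex-after zero    ys       zs p = reindex-↭ p , λ _ ()
reindex-after (suc K) []       zs p = reindex-↭ p , λ ()
reindex-after (suc K) (y ∷ ys) zs p =
  let (M , fixes) = reindex-after K ys zs p in
  reindex-cons y M , λ { zero _ → refl ; (suc i) (s≤s i<K) → cong suc (fixes i i<K) }

induced : ∀ {m n} → (Fin m → Fin n) → SimpleGraph n → SimpleGraph m
induced σ H = record
  { adj    = λ i j → adj H (σ i) (σ j)
  ; sym    = λ i j → SimpleGraph.sym H (σ i) (σ j)
  ; irrefl = λ i → irrefl H (σ i) }

induced-realizes : ∀ {xs ys} (M : Reindexing xs ys) (H : SimpleGraph (length ys)) →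
                   Realizes ys H → Realizes xs (induced (index M) H)
induced-realizes {xs} {ys} M H realizes i = begin
  degree (induced (index M) H) i ≡⟨ degree-finSum (induced (index M) H) i ⟩
  finSum (row ∘ index M)         ≡⟨ finSum-index M row ⟩
  finSum row                     ≡⟨ sym (degree-finSum H v) ⟩
  degree H v                     ≡⟨ realizes v ⟩
  lookup ys v                    ≡⟨ lookup-index M i ⟩
  lookup xs i                    ∎
  where
  open ≡-Reasoning
  v = index M i
  row = λ w → indicator (adj H v w)

data Decrement : ℕ → List ℕ → List ℕ → Set where
  done : ∀ {xs} → Decrement 0 xs xs
  skip : ∀ {k xs ys} → Decrement (suc k) xs ys → Decrement (suc k) (0 ∷ xs) (0 ∷ ys)
  hit  : ∀ {k x xs ys} → Decrement k xs ys → Decrement (suc k) (suc x ∷ xs) (x ∷ ys)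

decFirstNonzero-sound : ∀ d xs ys → decFirstNonzero d xs ≡ just ys → Decrement d xs ys
decFirstNonzero-sound zero    xs           .xs refl = done
decFirstNonzero-sound (suc k) []           ys  ()
decFirstNonzero-sound (suc k) (zero ∷ xs)  ys  e with decFirstNonzero (suc k) xs in eq
decFirstNonzero-sound (suc k) (zero ∷ xs)  .(zero ∷ zs) refl | just zs =
  skip (decFirstNonzero-sound (suc k) xs zs eq)
decFirstNonzero-sound (suc k) (suc x ∷ xs) ys  e with decFirstNonzero k xs in eq
decFirstNonzero-sound (suc k) (suc x ∷ xs) .(x ∷ zs) refl | just zs =
  hit (decFirstNonzero-sound k xs zs eq)

align : ∀ {d xs ys} → Decrement d xs ys → Fin (length xs) → Fin (length ys)
align done     i       = i
align (skip r) zero    = zero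
align (skip r) (suc i) = suc (align r i)
align (hit r)  zero    = zero
align (hit r)  (suc i) = suc (align r i)

hits : ∀ {d xs ys} → Decrement d xs ys → Fin (length xs) → Bool
hits done     i       = false
hits (skip r) zero    = false
hits (skip r) (suc i) = hits r i
hits (hit r)  zero    = true
hits (hit r)  (suc i) = hits r i

toℕ-align : ∀ {d xs ys} (r : Decrement d xs ys) → ∀ i → toℕ (align r i) ≡ toℕ i
toℕ-align done     i       = refl
toℕ-align (skip r) zero    = refl
toℕ-align (skip r) (suc i) = cong suc (toℕ-align r i)
toℕ-align (hit r)  zero    = refl
toℕ-align (hit r)  (suc i) = cong suc (toℕ-align r i)

lookup-align : ∀ {d xs ys} (r : Decrement d xs ys) →
               ∀ i → lookup ys (align r i) + indicator (hits r i) ≡ lookup xs i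
lookup-align done           i       = +-identityʳ _
lookup-align (skip r)       zero    = refl
lookup-align (skip r)       (suc i) = lookup-align r i
lookup-align (hit {x = x} r) zero   = +-comm x 1
lookup-align (hit r)        (suc i) = lookup-align r i

finSum-align : ∀ {d xs ys} (r : Decrement d xs ys) → ∀ g → finSum (g ∘ align r) ≡ finSum g
finSum-align done     g = refl
finSum-align (skip r) g = cong (g zero +_) (finSum-align r (g ∘ suc))
finSum-align (hit r)  g = cong (g zero +_) (finSum-align r (g ∘ suc))

finSum-hits : ∀ {d xs ys} (r : Decrement d xs ys) → finSum (indicator ∘ hits r) ≡ d
finSum-hits {xs = xs} done = finSum-zero (length xs)
finSum-hits (skip r)      = finSum-hits r
finSum-hits (hit r)       = cong suc (finSum-hits r)

hits-early : ∀ {d xs ys} (r : Decrement d xs ys) → ∀ i → toℕ i < d → lookup xs i ≢ 0 → hits r i ≡ true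
hits-early done     i       ()        _
hits-early (skip r) zero    _         nz = ⊥-elim (nz refl)
hits-early (skip r) (suc i) i<d       nz = hits-early r i (<-trans (n<1+n _) i<d) nz
hits-early (hit r)  zero    _         _  = refl
hits-early (hit r)  (suc i) (s≤s i<d) nz = hits-early r i i<d nz

length-decrement : ∀ {d xs ys} → Decrement d xs ys → length ys ≡ length xs
length-decrement done     = refl
length-decrement (skip r) = cong suc (length-decrement r)
length-decrement (hit r)  = cong suc (length-decrement r)

extend : ∀ {d xs ys} → Decrement d xs ys → SimpleGraph (length ys) → SimpleGraph (length (d ∷ xs))
extend {xs = xs} r H = record { adj = A ; sym = A-sym ; irrefl = A-irrefl }
  where
  A : Fin (suc (length xs)) → Fin (suc (length xs)) → Bool
  A zero    zero    = false
  A zero    (suc j) = hits r j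
  A (suc i) zero    = hits r i
  A (suc i) (suc j) = adj H (align r i) (align r j)
  A-sym : ∀ i j → A i j ≡ A j i
  A-sym zero    zero    = refl
  A-sym zero    (suc j) = refl
  A-sym (suc i) zero    = refl
  A-sym (suc i) (suc j) = SimpleGraph.sym H (align r i) (align r j)
  A-irrefl : ∀ i → A i i ≡ false
  A-irrefl zero    = refl
  A-irrefl (suc i) = irrefl H (align r i)

extend-realizes : ∀ {d xs ys} (r : Decrement d xs ys) (H : SimpleGraph (length ys)) →
                  Realizes ys H → Realizes (d ∷ xs) (extend r H)
extend-realizes r H realizes zero = trans (degree-finSum (extend r H) zero) (finSum-hits r)
extend-realizes {xs = xs} {ys} r H realizes (suc i) = begin
  degree (extend r H) (suc i) ≡⟨ degree-finSum (extend r H) (suc i) ⟩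
  h + finSum (row ∘ align r)  ≡⟨ cong (h +_) (finSum-align r row) ⟩
  h + finSum row              ≡⟨ cong (h +_) (sym (degree-finSum H v)) ⟩
  h + degree H v              ≡⟨ cong (h +_) (realizes v) ⟩
  h + lookup ys v             ≡⟨ +-comm h _ ⟩
  lookup ys v + h             ≡⟨ lookup-align r i ⟩
  lookup xs i                 ∎
  where
  open ≡-Reasoning
  v = align r i
  h = indicator (hits r i)
  row = λ w → indicator (adj H v w)

-- The 0-indexed entry d_{p+1} (0 beyond the end).
entry : List ℕ → ℕ → ℕ
entry xs p = nth xs (suc p)

entry-lookup : ∀ xs (i : Fin (length xs)) → entry xs (toℕ i) ≡ lookup xs i
entry-lookup (x ∷ xs) zero    = refl
entry-lookup (x ∷ xs) (suc i) = entry-lookup xs i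

entry-prefix : ∀ K ys zs p → p < K → p < length ys → entry (take K ys ++ zs) p ≡ entry ys p
entry-prefix (suc K) (y ∷ ys) zs zero    _         _         = refl
entry-prefix (suc K) (y ∷ ys) zs (suc p) (s≤s p<K) (s≤s p<l) = entry-prefix K ys zs p p<K p<l

entry-decrement : ∀ {d xs ys} → Decrement d xs ys → ∀ p → entry xs p ∸ 1 ≤ entry ys p
entry-decrement done     p       = m∸n≤m _ 1
entry-decrement (skip r) zero    = z≤n
entry-decrement (skip r) (suc p) = entry-decrement r p
entry-decrement (hit r)  zero    = ≤-refl
entry-decrement (hit r)  (suc p) = entry-decrement r p

entry-head : ∀ {a xs} → NonIncreasing (a ∷ xs) → ∀ y → entry (a ∷ xs) y ≤ a
entry-head _                      zero    = ≤-refl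
entry-head {xs = []}     _        (suc y) = z≤n
entry-head {xs = b ∷ xs} (a≥b ∷ l) (suc y) = ≤-trans (entry-head l y) a≥b

entry-antitone : ∀ {xs} → NonIncreasing xs → ∀ {x y} → x ≤ y → entry xs y ≤ entry xs x
entry-antitone {[]}         _       _         = z≤n
entry-antitone {a ∷ xs}     l       {zero} {y} _ = entry-head l y
entry-antitone {a ∷ []}     _       {suc x} {suc y} _ = z≤n
entry-antitone {a ∷ b ∷ xs} (_ ∷ l) {suc x} {suc y} (s≤s x≤y) = entry-antitone l x≤y

last-entry-least : ∀ {xs n x} → NonIncreasing xs → x < n → nth xs n ≤ entry xs x
last-entry-least {n = suc n} l (s≤s x≤n) = entry-antitone l x≤n

sortDesc-↭ : ∀ xs → sortDesc xs ↭ xs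
sortDesc-↭ xs = ↭-trans (↭-reverse (sort xs)) (sort-↭ xs)

reorderLast-reindexing : ∀ m ys →
  Σ (Reindexing ys (reorderLast m ys)) λ M → ∀ i → toℕ i < length ys ∸ m → toℕ (index M i) ≡ toℕ i
reorderLast-reindexing m ys = reindex-after K ys _ (↭-sym (sortDesc-↭ (drop K ys)))
  where K = length ys ∸ m

length-reorderLast : ∀ m ys → length (reorderLast m ys) ≡ length ys
length-reorderLast m ys =
  trans (↭-length (++⁺ˡ (take K ys) (sortDesc-↭ (drop K ys)))) (cong length (take++drop≡id K ys))
  where K = length ys ∸ m

layStep-inversion : ∀ m πk π′ → layStep m πk ≡ just π′ →
  Σ ℕ λ d → Σ (List ℕ) λ xs → Σ (List ℕ) λ ys →
    πk ≡ d ∷ xs × Decrement d xs ys × π′ ≡ reorderLast m ys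
layStep-inversion m []       π′ ()
layStep-inversion m (d ∷ xs) π′ e with decFirstNonzero d xs in eq
layStep-inversion m (d ∷ xs) .(reorderLast m ys) refl | just ys =
  d , xs , ys , refl , decFirstNonzero-sound d xs ys eq , refl

laying-defined-before : ∀ n t π r k {z} → laying n t (r + k) π ≡ just z →
                        Σ (List ℕ) λ y → laying n t k π ≡ just y
laying-defined-before n t π zero    k e = _ , e
laying-defined-before n t π (suc r) k e with laying n t (r + k) π in eq
... | just w = laying-defined-before n t π r k eq

window : ∀ a p c n → a + p < c → c ≤ n → p < (n ∸ a) ∸ (n ∸ c)
window a p c n a+p<c c≤n =
  subst (p <_) (sym gap) (m+n≤o⇒m≤o∸n (suc p) (subst (_≤ c) (cong suc (+-comm a p)) a+p<c))
  where
  a≤c : a ≤ c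
  a≤c = ≤-trans (m≤m+n a p) (<⇒≤ a+p<c)
  gap : (n ∸ a) ∸ (n ∸ c) ≡ c ∸ a
  gap = begin
    (n ∸ a) ∸ (n ∸ c)             ≡⟨ cong (λ z → (z ∸ a) ∸ (n ∸ c)) (sym (m∸n+n≡m c≤n)) ⟩
    ((n ∸ c) + c ∸ a) ∸ (n ∸ c)   ≡⟨ cong (_∸ (n ∸ c)) (+-∸-assoc (n ∸ c) a≤c) ⟩
    ((n ∸ c) + (c ∸ a)) ∸ (n ∸ c) ≡⟨ m+n∸m≡n (n ∸ c) (c ∸ a) ⟩
    c ∸ a                         ∎
    where open ≡-Reasoning

-- The laying-off of a fixed π of length n ≥ 3t; m = n - 3t is the length of
-- the reordered tail.
module LayingOff (n t : ℕ) (π : List ℕ) (len : length π ≡ n) (3t≤n : 3 * t ≤ n) where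

  m : ℕ
  m = n ∸ 3 * t

  decrement-length : ∀ {k d xs ys} → length (d ∷ xs) ≡ n ∸ k → Decrement d xs ys → length ys ≡ n ∸ suc k
  decrement-length {k} l r = trans (length-decrement r) (trans (cong pred l) (pred[m∸n]≡m∸[1+n] n k))

  laying-length : ∀ k {πk} → laying n t k π ≡ just πk → length πk ≡ n ∸ k
  laying-length zero refl = len
  laying-length (suc k) {π′} e with laying n t k π in eq
  ... | just πk with layStep-inversion m πk π′ e
  ... | d , xs , ys , refl , r , refl = trans (length-reorderLast m ys) (decrement-length (laying-length k eq) r)

  -- Positions p of π_{k+1} with k+1+p < 3t are untouched by the reordering.
  in-prefix : ∀ {k p} (ys : List ℕ) → length ys ≡ n ∸ suc k → suc k + p < 3 * t → p < length ys ∸ m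
  in-prefix {k} {p} ys l lt = subst (λ z → p < z ∸ m) (sym l) (window (suc k) p (3 * t) n lt 3t≤n)

  -- Each step decreases every term of the window by at most one.
  laying-lower-bound : ∀ k {πk} → laying n t k π ≡ just πk →
                       ∀ p → k + p < 3 * t → entry π (k + p) ∸ k ≤ entry πk p
  laying-lower-bound zero refl p _ = ≤-refl
  laying-lower-bound (suc k) {π′} e with laying n t k π in eq
  ... | just πk with layStep-inversion m πk π′ e
  ... | d , xs , ys , refl , r , refl = bound
    where
    ys-length : length ys ≡ n ∸ suc k
    ys-length = decrement-length (laying-length k eq) r
    bound : ∀ p → suc k + p < 3 * t → entry π (suc k + p) ∸ suc k ≤ entry (reorderLast m ys) p
    bound p lt = begin
      entry π (suc k + p) ∸ suc k        ≡⟨ cong (λ z → entry π z ∸ suc k) (sym (+-suc k p)) ⟩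
      entry π (k + suc p) ∸ suc k        ≡⟨ cong (entry π (k + suc p) ∸_) (+-comm 1 k) ⟩
      entry π (k + suc p) ∸ (k + 1)      ≡⟨ sym (∸-+-assoc (entry π (k + suc p)) k 1) ⟩
      (entry π (k + suc p) ∸ k) ∸ 1      ≤⟨ ∸-monoˡ-≤ 1 (laying-lower-bound k eq (suc p) k+p+1<3t) ⟩
      entry xs p ∸ 1                     ≤⟨ entry-decrement r p ⟩
      entry ys p                         ≡⟨ sym (entry-prefix K ys _ p p<K (≤-trans p<K (m∸n≤m _ m))) ⟩
      entry (reorderLast m ys) p         ∎
      where
      open ≤-Reasoning
      K = length ys ∸ m
      p<K : p < K
      p<K = in-prefix ys ys-length lt
      k+p+1<3t : k + suc p < 3 * t
      k+p+1<3t = subst (_< 3 * t) (sym (+-suc k p)) lt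

record Pattern (t a b : ℕ) : Set where
  constructor mkPattern
  field
    ordered : a < b
    within  : suc a + 2 * b ≤ 6 * t
open Pattern

⌈/2⌉≤ : ∀ {m N} → m ≤ N + N → ⌈ m /2⌉ ≤ N
⌈/2⌉≤ {m} {N} m≤2N = subst (⌈ m /2⌉ ≤_) (sym (n≡⌈n+n/2⌉ N)) (⌈n/2⌉-mono m≤2N)

half-room : ∀ {m} b N → m + (b + b) ≤ N + N → b + ⌈ m /2⌉ ≤ N
half-room {m} zero    N       le = ⌈/2⌉≤ (subst (_≤ N + N) (+-identityʳ m) le)
half-room {m} (suc b) zero    le with ≤-trans (m≤n+m (suc b + suc b) m) le
... | ()
half-room {m} (suc b) (suc N) le = s≤s (half-room b N (≤-pred (≤-pred (subst₂ _≤_ (lhs m b) (rhs N) le))))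
  where
  lhs : ∀ m b → m + (suc b + suc b) ≡ suc (suc (m + (b + b)))
  lhs = solve-∀
  rhs : ∀ N → suc N + suc N ≡ suc (suc (N + N))
  rhs = solve-∀

pattern-room : ∀ {t a b} → Pattern t a b → b + ⌈ suc a /2⌉ ≤ 3 * t
pattern-room {t} {a} {b} (mkPattern _ le) =
  half-room b (3 * t) (subst₂ _≤_ (cong (suc a +_) (double b)) (sextuple t) le)
  where
  double : ∀ b → 2 * b ≡ b + b
  double = solve-∀
  sextuple : ∀ t → 6 * t ≡ 3 * t + 3 * t
  sextuple = solve-∀

pattern-bounded : ∀ {t a b} → Pattern t a b → b < 3 * t
pattern-bounded {b = b} pat = <-≤-trans (m<m+n b (s≤s z≤n)) (pattern-room pat)

pattern-source : ∀ {t a b} → Pattern t a b → a < 2 * t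
pattern-source {t} {a} {b} (mkPattern a<b le) =
  *-cancelˡ-≤ 3 (≤-trans (+-monoʳ-≤ (suc a) (*-monoʳ-≤ 2 a<b)) (subst (suc a + 2 * b ≤_) (e t) le))
  where
  e : ∀ t → 6 * t ≡ 3 * (2 * t)
  e = solve-∀

pattern-beyond : ∀ {t a b} → Pattern t a b → 2 * t < b → suc a ≤ 2 * t ∸ 1
pattern-beyond {t} {a} {b} (mkPattern _ le) 2t<b =
  m+n≤o⇒m≤o∸n (suc a) (+-cancelʳ-≤ (4 * t) (suc a + 1) (2 * t) chain)
  where
  open ≤-Reasoning
  e₁ : ∀ a t → suc a + 2 * suc (2 * t) ≡ suc ((suc a + 1) + 4 * t)
  e₁ = solve-∀
  e₂ : ∀ t → 6 * t ≡ 2 * t + 4 * t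
  e₂ = solve-∀
  chain : (suc a + 1) + 4 * t ≤ 2 * t + 4 * t
  chain = begin
    (suc a + 1) + 4 * t         ≤⟨ n≤1+n _ ⟩
    suc ((suc a + 1) + 4 * t)   ≡⟨ sym (e₁ a t) ⟩
    suc a + 2 * suc (2 * t)     ≤⟨ +-monoʳ-≤ (suc a) (*-monoʳ-≤ 2 2t<b) ⟩
    suc a + 2 * b               ≤⟨ le ⟩
    6 * t                       ≡⟨ e₂ t ⟩
    2 * t + 4 * t               ∎

clique-pattern : ∀ {t a b} → a < b → b < 2 * t → Pattern t a b
clique-pattern {t} {a} {b} a<b b<2t =
  mkPattern a<b (subst (suc a + 2 * b ≤_) (e t) (+-mono-≤ (<-trans a<b b<2t) (*-monoʳ-≤ 2 (<⇒≤ b<2t))))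
  where
  e : ∀ t → 2 * t + 2 * (2 * t) ≡ 6 * t
  e = solve-∀

-- Conditions (i)–(iii) of the proposition on the first 3t terms, 0-indexed.
record DegreeConditions (t : ℕ) (π : List ℕ) : Set where
  field
    head-terms  : ∀ x → x < 2 * t → 3 * t ∸ ⌈ suc x /2⌉ ≤ entry π x
    middle-term : 2 * t ≤ entry π (2 * t)
    tail-terms  : ∀ x → x < 3 * t → 2 * t ∸ 1 ≤ entry π x
open DegreeConditions

pattern-degree : ∀ {t π a b} → DegreeConditions t π → Pattern t a b → a < entry π b
pattern-degree {t} {π} {a} {b} conds pat@(mkPattern a<b _) with <-cmp b (2 * t)
... | tri< b<2t _ _ = <-≤-trans (<-trans a<b b<2t) (≤-trans 2t≤ (head-terms conds b b<2t))
  where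
  half-b≤t : ⌈ suc b /2⌉ ≤ t
  half-b≤t = ⌈/2⌉≤ (subst (suc b ≤_) (cong (t +_) (+-identityʳ t)) b<2t)
  e : ∀ t → 2 * t + t ≡ 3 * t
  e = solve-∀
  2t≤ : 2 * t ≤ 3 * t ∸ ⌈ suc b /2⌉
  2t≤ = m+n≤o⇒m≤o∸n (2 * t) (subst (2 * t + ⌈ suc b /2⌉ ≤_) (e t) (+-monoʳ-≤ (2 * t) half-b≤t))
... | tri≈ _ refl _ = <-≤-trans a<b (middle-term conds)
... | tri> _ _ 2t<b = ≤-trans (pattern-beyond pat 2t<b) (tail-terms conds b (pattern-bounded pat))

within-reach : ∀ k j c N → (k + suc j) + c ≤ N → suc j ≤ (N ∸ c) ∸ k
within-reach k j c N le =
  m+n≤o⇒m≤o∸n (suc j) (m+n≤o⇒m≤o∸n (suc j + k) (subst (λ z → z + c ≤ N) (+-comm k (suc j)) le))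

module Reconstruction (n t : ℕ) (π : List ℕ) (len : length π ≡ n) (3t≤n : 3 * t ≤ n)
                      (conds : DegreeConditions t π) where
  open LayingOff n t π len 3t≤n

  PatternRealization : ℕ → List ℕ → Set
  PatternRealization k πk =
    Σ (SimpleGraph (length πk)) λ H → Realizes πk H ×
      (∀ i j → Pattern t (k + toℕ i) (k + toℕ j) → adj H i j ≡ true)

  -- The vertex deleted at step k was joined to position j + 1 of the rest
  -- whenever Pattern k (k + j + 1): that position lies among the first
  -- d^{(k)}_k, and its term is still positive.
  new-vertex-reaches : ∀ k {d xs ys} → laying n t k π ≡ just (d ∷ xs) → (r : Decrement d xs ys) →
                       ∀ j → Pattern t k (k + suc (toℕ j)) → hits r j ≡ true
  new-vertex-reaches k {d} {xs} lay-k r j pat = hits-early r j j<d nonzero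
    where
    k-in : k + 0 < 3 * t
    k-in = subst (_< 3 * t) (sym (+-identityʳ k)) (<-trans (ordered pat) (pattern-bounded pat))
    d-bound : entry π k ∸ k ≤ d
    d-bound = subst (λ z → entry π z ∸ k ≤ d) (+-identityʳ k) (laying-lower-bound k lay-k 0 k-in)
    j<d : toℕ j < d
    j<d = ≤-trans (within-reach k (toℕ j) _ (3 * t) (pattern-room pat))
            (≤-trans (∸-monoˡ-≤ k (head-terms conds k (pattern-source pat))) d-bound)
    term-bound : entry π (k + suc (toℕ j)) ∸ k ≤ lookup xs j
    term-bound = subst (entry π (k + suc (toℕ j)) ∸ k ≤_) (entry-lookup xs j)
                   (laying-lower-bound k lay-k (suc (toℕ j)) (pattern-bounded pat))
    nonzero : lookup xs j ≢ 0
    nonzero z = m>n⇒m∸n≢0 (pattern-degree conds pat) (n≤0⇒n≡0 (≤-trans term-bound (≤-reflexive z)))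

  -- Old positions below 3t - k - 1 keep their
  -- place, so pattern pairs between them survive; pairs with the new vertex are
  -- supplied by `new-vertex-reaches`.
  undo-step : ∀ k πk π′ → laying n t k π ≡ just πk → layStep m πk ≡ just π′ →
              PatternRealization (suc k) π′ → PatternRealization k πk
  undo-step k πk π′ lay-k step (H , realizes , pattern-adj) with layStep-inversion m πk π′ step
  ... | d , xs , ys , refl , r , refl =
    G , extend-realizes r H₁ (induced-realizes M H realizes) , adjacent
    where
    M = proj₁ (reorderLast-reindexing m ys)
    H₁ = induced (index M) H
    G = extend r H₁
    ys-length : length ys ≡ n ∸ suc k
    ys-length = decrement-length (laying-length k lay-k) r
    carry : Fin (length xs) → Fin (length (reorderLast m ys))
    carry i = index M (align r i)
    toℕ-carry : ∀ i → suc k + toℕ i < 3 * t → toℕ (carry i) ≡ toℕ i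
    toℕ-carry i lt =
      trans (proj₂ (reorderLast-reindexing m ys) (align r i)
              (subst (_< length ys ∸ m) (sym (toℕ-align r i)) (in-prefix ys ys-length lt)))
            (toℕ-align r i)
    shift : ∀ i → suc k + toℕ i < 3 * t → k + suc (toℕ i) ≡ suc k + toℕ (carry i)
    shift i lt = trans (+-suc k (toℕ i)) (cong (suc k +_) (sym (toℕ-carry i lt)))
    adjacent : ∀ i j → Pattern t (k + toℕ i) (k + toℕ j) → adj G i j ≡ true
    adjacent zero    zero    (mkPattern lt _) = ⊥-elim (<-irrefl refl lt)
    adjacent (suc i) zero    (mkPattern lt _) = ⊥-elim (<⇒≱ lt (+-monoʳ-≤ k z≤n))
    adjacent zero    (suc j) pat =
      new-vertex-reaches k lay-k r j (subst (λ a → Pattern t a (k + suc (toℕ j))) (+-identityʳ k) pat)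
    adjacent (suc i) (suc j) pat =
      pattern-adj (carry i) (carry j) (subst₂ (Pattern t) (shift i i-in) (shift j j-in) pat)
      where
      j-in : suc k + toℕ j < 3 * t
      j-in = subst (_< 3 * t) (+-suc k (toℕ j)) (pattern-bounded pat)
      i-in : suc k + toℕ i < 3 * t
      i-in = <-trans (subst₂ _<_ (+-suc k (toℕ i)) (+-suc k (toℕ j)) (ordered pat)) j-in

  -- Downward induction on k, r = 3t - k steps remaining.  At k = 3t any
  -- realization will do, since pattern pairs lie below 3t.
  realize : ∀ {π3t} → laying n t (3 * t) π ≡ just π3t → Graphic π3t →
            ∀ r k → r + k ≡ 3 * t → ∀ πk → laying n t k π ≡ just πk → PatternRealization k πk
  realize lay3t (_ , H , realizes) zero k refl πk lay-k with trans (sym lay-k) lay3t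
  ... | refl = H , realizes , λ i j pat → ⊥-elim (<⇒≱ (pattern-bounded pat) (m≤m+n (3 * t) (toℕ j)))
  realize {π3t} lay3t graphic (suc r) k r+k≡3t πk lay-k =
    undo-step k πk π′ lay-k step (realize lay3t graphic r (suc k) r+sk≡3t π′ lay-sk)
    where
    r+sk≡3t : r + suc k ≡ 3 * t
    r+sk≡3t = trans (+-suc r k) r+k≡3t
    next : Σ (List ℕ) λ y → laying n t (suc k) π ≡ just y
    next = laying-defined-before n t π r (suc k) (subst (λ z → laying n t z π ≡ just π3t) (sym r+sk≡3t) lay3t)
    π′ = proj₁ next
    lay-sk = proj₂ next
    step : layStep m πk ≡ just π′
    step = subst (λ z → (z >>= layStep m) ≡ just π′) lay-k lay-sk

-- The position of the G(3t)-vertex with index x: v_{x+1} stays at x, and x_i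
-- (index 2t + i - 1) goes to position 3t - i.
place : ℕ → ℕ → ℕ
place t x with x <? 2 * t
... | yes _ = x
... | no  _ = 2 * t + (3 * t ∸ suc x)

place-low : ∀ t x → x < 2 * t → place t x ≡ x
place-low t x x<2t with x <? 2 * t
... | yes _   = refl
... | no  x≮ = ⊥-elim (x≮ x<2t)

place-high : ∀ t x → 2 * t ≤ x → place t x ≡ 2 * t + (3 * t ∸ suc x)
place-high t x 2t≤x with x <? 2 * t
... | yes x<2t = ⊥-elim (<⇒≱ x<2t 2t≤x)
... | no  _    = refl

x-offset<t : ∀ t q → 2 * t + q < 3 * t → q < t
x-offset<t t q lt = +-cancelˡ-< (2 * t) q t (subst (2 * t + q <_) (e t) lt)
  where
  e : ∀ t → 3 * t ≡ 2 * t + t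
  e = solve-∀

high-split : ∀ t x → 2 * t ≤ x → x < 3 * t →
  Σ ℕ λ q → Σ ℕ λ w → t ≡ suc q + w × x ≡ 2 * t + q × 3 * t ∸ suc x ≡ w
high-split t x 2t≤x x<3t with m≤n⇒∃[o]m+o≡n 2t≤x
... | q , refl with m≤n⇒∃[o]m+o≡n (x-offset<t t q x<3t)
... | w , refl = q , w , refl , refl , gap
  where
  e : ∀ q w → 3 * (suc q + w) ≡ suc (2 * (suc q + w) + q) + w
  e = solve-∀
  gap : 3 * (suc q + w) ∸ suc (2 * (suc q + w) + q) ≡ w
  gap = trans (cong (_∸ suc (2 * (suc q + w) + q)) (e q w)) (m+n∸m≡n (suc (2 * (suc q + w) + q)) w)

place-bound : ∀ t x → x < 3 * t → place t x < 3 * t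
place-bound t x x<3t with x <? 2 * t
... | yes _  = x<3t
... | no x≮ with high-split t x (≮⇒≥ x≮) x<3t
... | q , w , refl , refl , gap =
  subst (λ z → 2 * T + z < 3 * T) (sym gap)
    (subst (2 * T + w <_) (sym (e q w)) (+-monoʳ-< (2 * T) (s≤s (m≤n+m w q))))
  where
  T = suc q + w
  e : ∀ q w → 3 * (suc q + w) ≡ 2 * (suc q + w) + (suc q + w)
  e = solve-∀

place-injective : ∀ t x y → x < 3 * t → y < 3 * t → place t x ≡ place t y → x ≡ y
place-injective t x y x<3t y<3t e with x <? 2 * t | y <? 2 * t
... | yes _   | yes _   = e
... | yes x<2t | no _   = ⊥-elim (<⇒≱ x<2t (subst (2 * t ≤_) (sym e) (m≤m+n _ _)))
... | no _    | yes y<2t = ⊥-elim (<⇒≱ y<2t (subst (2 * t ≤_) e (m≤m+n _ _)))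
... | no _    | no _    = suc-injective (∸-cancelˡ-≡ x<3t y<3t (+-cancelˡ-≡ (2 * t) _ _ e))

x-edge-pattern : ∀ t x y → 2 * t ≤ x → x < 3 * t → y < 2 * suc (x ∸ 2 * t) →
                 y < 2 * t × Pattern t y (place t x)
x-edge-pattern t x y 2t≤x x<3t y<2i with high-split t x 2t≤x x<3t
... | q , w , refl , refl , gap = y<2t , subst (Pattern T y) (sym place-x) (mkPattern y<2T+w sum-bound)
  where
  T = suc q + w
  place-x : place T (2 * T + q) ≡ 2 * T + w
  place-x = trans (place-high T (2 * T + q) 2t≤x) (cong (2 * T +_) gap)
  y<2q+2 : suc y ≤ 2 * suc q
  y<2q+2 = subst (λ z → suc y ≤ 2 * suc z) (m+n∸m≡n (2 * T) q) y<2i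
  y<2t : y < 2 * T
  y<2t = ≤-trans y<2q+2 (*-monoʳ-≤ 2 (m≤m+n (suc q) w))
  y<2T+w : y < 2 * T + w
  y<2T+w = ≤-trans y<2t (m≤m+n _ w)
  e : ∀ q w → 2 * suc q + 2 * (2 * (suc q + w) + w) ≡ 6 * (suc q + w)
  e = solve-∀
  sum-bound : suc y + 2 * (2 * T + w) ≤ 6 * T
  sum-bound = subst (suc y + 2 * (2 * T + w) ≤_) (e q w) (+-monoˡ-≤ _ y<2q+2)

edge-pattern : ∀ t {x y} → x < 3 * t → y < 3 * t → GEdge′ t x y →
               Pattern t (place t x) (place t y) ⊎ Pattern t (place t y) (place t x)
edge-pattern t {x} {y} _ _ (inj₁ (x<2t , y<2t , x≢y))
  rewrite place-low t x x<2t | place-low t y y<2t with <-cmp x y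
... | tri< x<y _ _ = inj₁ (clique-pattern x<y y<2t)
... | tri≈ _ x≡y _ = ⊥-elim (x≢y x≡y)
... | tri> _ _ y<x = inj₂ (clique-pattern y<x x<2t)
edge-pattern t {x} {y} _ _ (inj₂ (2t≤x , x<3t , y<2i)) =
  let (y<2t , pat) = x-edge-pattern t x y 2t≤x x<3t y<2i in
  inj₂ (subst (λ z → Pattern t z (place t x)) (sym (place-low t y y<2t)) pat)

contains-G3t : ∀ t {L} (H : SimpleGraph L) → 3 * t ≤ L →
               (∀ i j → Pattern t (toℕ i) (toℕ j) → adj H i j ≡ true) → ContainsG3t t H
contains-G3t t {L} H 3t≤L pattern-adj = f , f-injective , edges
  where
  f : Fin (3 * t) → Fin L
  f a = fromℕ< (<-≤-trans (place-bound t (toℕ a) (toℕ<n a)) 3t≤L)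
  toℕ-f : ∀ a → toℕ (f a) ≡ place t (toℕ a)
  toℕ-f a = toℕ-fromℕ< _
  f-injective : ∀ {a b} → f a ≡ f b → a ≡ b
  f-injective {a} {b} e = toℕ-injective (place-injective t _ _ (toℕ<n a) (toℕ<n b)
                            (trans (sym (toℕ-f a)) (trans (cong toℕ e) (toℕ-f b))))
  adjacent : ∀ a b → Pattern t (place t (toℕ a)) (place t (toℕ b)) ⊎
                     Pattern t (place t (toℕ b)) (place t (toℕ a)) → adj H (f a) (f b) ≡ true
  adjacent a b (inj₁ pat) = pattern-adj (f a) (f b) (subst₂ (Pattern t) (sym (toℕ-f a)) (sym (toℕ-f b)) pat)
  adjacent a b (inj₂ pat) = trans (SimpleGraph.sym H (f a) (f b))
                              (pattern-adj (f b) (f a) (subst₂ (Pattern t) (sym (toℕ-f b)) (sym (toℕ-f a)) pat))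
  edges : ∀ a b → GEdge t a b → adj H (f a) (f b) ≡ true
  edges a b (inj₁ e) = adjacent a b (edge-pattern t (toℕ<n a) (toℕ<n b) e)
  edges a b (inj₂ e) = adjacent a b (⊎-swap (edge-pattern t (toℕ<n b) (toℕ<n a) e))

-- Proposition 4.1.1.
proposition4p1p1 : (t n : ℕ) (π : List ℕ) → 2 ≤ t → 18 * t ≤ n → length π ≡ n →
    Graphic π →
    (∀ i → 1 ≤ i → i ≤ 2 * t → nth π i ≥ 3 * t ∸ ⌈ i /2⌉) →
    nth π (suc (2 * t)) ≥ 2 * t →
    nth π n ≥ 2 * t ∸ 1 →
    (Σ (List ℕ) λ π3t → laying n t (3 * t) π ≡ just π3t × Graphic π3t) →
    Σ (SimpleGraph (length π)) λ G → Realizes π G × ContainsG3t t G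
proposition4p1p1 t n π _ 18t≤n len (non-increasing , _) cond-i cond-ii cond-iii (_ , lay3t , graphic) =
  H , realizes , contains-G3t t H (subst (3 * t ≤_) (sym len) 3t≤n) pattern-adj
  where
  3t≤n : 3 * t ≤ n
  3t≤n = ≤-trans (*-monoˡ-≤ t 3≤18) 18t≤n
    where
    3≤18 : 3 ≤ 18
    3≤18 = s≤s (s≤s (s≤s z≤n))
  conds : DegreeConditions t π
  conds = record
    { head-terms  = λ x x<2t → cond-i (suc x) (s≤s z≤n) x<2t
    ; middle-term = cond-ii
    ; tail-terms  = λ x x<3t → ≤-trans cond-iii (last-entry-least non-increasing (<-≤-trans x<3t 3t≤n)) }
  open Reconstruction n t π len 3t≤n conds
  realization : PatternRealization 0 π
  realization = realize lay3t graphic (3 * t) 0 (+-identityʳ _) π refl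
  H = proj₁ realization
  realizes = proj₁ (proj₂ realization)
  pattern-adj = proj₂ (proj₂ realization)
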